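{- If $r,s\ge 1$, then $\mathrm{mob}(K_r\odot K_s)=\max\{r,s+1\}$.
   Context: For graphs $G$ with $V(G)=\{v_1,\dots,v_n\}$ and $H$, the corona product $G\odot H$ is obtained from one copy of $G$ and $n$ disjoint copies $H^1,\dots,H^n$ of $H$ by joining $v_i$ to every vertex of $H^i$. A set $S\subseteq V(G)$ is a general position set if no three vertices of $S$ lie on a common shortest path. Robots are placed one per vertex of a general position set $S$; a move $u\to v$ along an edge $uv$ with $u\in S$ is legal if $v\notin S$ and $(S\setminus\{u\})\cup\{v\}$ is a general position set. $S$ is a mobile general position set if some sequence of legal moves starting from $S$ visits every vertex at least once; $\mathrm{mob}(G)$ is the maximum size of a mobile general position set. -}

module Defs where

open import Level using (0ℓ)
open import Data.Nat using (ℕ; suc; _≤_; _⊔_)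
open import Data.Fin using (Fin)
open import Data.Sum using (_⊎_; inj₁; inj₂)
open import Data.Product using (Σ; ∃; ∃-syntax; _×_; _,_)
open import Data.List using (List; []; _∷_; length)
open import Data.List.Membership.Propositional using (_∈_; _∉_)
open import Data.List.Relation.Unary.Any using (Any)
open import Data.List.Relation.Unary.Unique.Propositional using (Unique)
open import Data.List.Relation.Binary.Permutation.Propositional using (_↭_)
open import Relation.Binary.PropositionalEquality using (_≡_; _≢_)
open import Relation.Nullary using (¬_)

record Graph : Set₁ where
  field
    V : Set
    E : V → V → Set

open Graph public

K : ℕ → Graph
K n = record { V = Fin n ; E = λ i j → i ≢ j }

-- Corona product G ⊙ H: vertices of G (inj₁ v) and, for each v of G,
-- a copy of H (inj₂ (v , h)); v is joined to every vertex of its copy H^v.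
CE : (G H : Graph) → V G ⊎ (V G × V H) → V G ⊎ (V G × V H) → Set
CE G H (inj₁ a) (inj₁ b) = E G a b
CE G H (inj₁ a) (inj₂ (b , h)) = a ≡ b
CE G H (inj₂ (a , h)) (inj₁ b) = a ≡ b
CE G H (inj₂ (a , h)) (inj₂ (b , h')) = (a ≡ b) × E H h h'

_⊙_ : Graph → Graph → Graph
G ⊙ H = record { V = V G ⊎ (V G × V H) ; E = CE G H }

module _ (G : Graph) where

  data Walk : V G → V G → Set where
    [_] : (x : V G) → Walk x x
    _∷ʷ_ : ∀ {x y z} → E G x y → Walk y z → Walk x z

  walkLength : ∀ {x y} → Walk x y → ℕ
  walkLength [ x ] = 0
  walkLength (e ∷ʷ w) = suc (walkLength w)

  data OnWalk (v : V G) : ∀ {x y} → Walk x y → Set where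
    here-end : OnWalk v [ v ]
    here-step : ∀ {y z} (e : E G v y) (w : Walk y z) → OnWalk v (e ∷ʷ w)
    there : ∀ {x y z} (e : E G x y) {w : Walk y z} → OnWalk v w → OnWalk v (e ∷ʷ w)

  IsShortest : ∀ {x y} → Walk x y → Set
  IsShortest {x} {y} w = ∀ (w' : Walk x y) → walkLength w ≤ walkLength w'

  OnCommonGeodesic : V G → V G → V G → Set
  OnCommonGeodesic a b c =
    ∃[ x ] ∃[ y ] Σ (Walk x y) λ w →
      IsShortest w × OnWalk a w × OnWalk b w × OnWalk c w

  IsGP : List (V G) → Set
  IsGP S = Unique S ×
    (∀ {a b c} → a ∈ S → b ∈ S → c ∈ S → a ≢ b → a ≢ c → b ≢ c →
       ¬ OnCommonGeodesic a b c)

  LegalMove : List (V G) → List (V G) → Set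
  LegalMove S S' = ∃[ u ] ∃[ v ] ∃[ T ]
    (S ↭ (u ∷ T)) × E G u v × v ∉ S × (S' ≡ v ∷ T) × IsGP S'

  data MoveSeq : List (V G) → List (List (V G)) → Set where
    done : ∀ {S} → MoveSeq S []
    step : ∀ {S S' cs} → LegalMove S S' → MoveSeq S' cs → MoveSeq S (S' ∷ cs)

  -- Mobile general position set: some sequence of legal moves visits every vertex
  -- (the initial configuration counts as visited).
  IsMobileGP : List (V G) → Set
  IsMobileGP S = IsGP S × ∃[ cs ] (MoveSeq S cs ×
    (∀ (x : V G) → (x ∈ S) ⊎ Any (x ∈_) cs))

  MobIs : ℕ → Set
  MobIs k = (∃[ S ] (IsMobileGP S × length S ≡ k))
          × (∀ S → IsMobileGP S → length S ≤ k)

{-# OPTIONS --safe #-}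
module Submission where

-- General position is tested through the graph distance d: of three vertices on a
-- common geodesic one lies between the other two, so no isosceles triple
-- d(a,b) = d(a,c) with 0 < d(b,c) < 2 d(a,b) lies on one.  In K_r ⊙ K_s every block
-- {v_i} ∪ H^i is a clique, and vertices of different blocks are joined through
-- their cores, which makes all needed distances explicit.
--
-- Lower bound: the r cores form a mobile general position set (in turn, the robot
-- at v_i tours H^i and comes back), and so does a block {v_o} ∪ H^o of size s + 1
-- (its robot at v_o tours every other block).
--
-- Upper bound: let S be a general position set with |S| ≥ s + 2.  Some vertex x of
-- S lies outside block i, and v_i lies between a leaf of H^i and x; so S never
-- contains both v_i and a leaf of H^i.  If S holds two leaves of H^i, a legal move
-- can only take one of them to another leaf of H^i, so v_i is never visited.  A
-- mobile S of this size thus has at most one vertex per block: |S| ≤ r.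

open import Defs
open import Data.Bool using (if_then_else_)
open import Data.Nat using (ℕ; suc; _≤_; _<_; _+_; _⊔_; _≤?_; z≤n; s≤s; z<s; s<s)
open import Data.Nat.Properties
  using ( ≤-refl; ≤-reflexive; ≤-trans; n≤1+n; m≤n+m; <⇒≱; ≰⇒>; m<m+n
        ; +-comm; +-assoc; +-mono-≤; +-monoˡ-≤; +-monoʳ-≤; +-cancelˡ-≤; +-cancelʳ-≤
        ; ⊔-sel; m≤n⇒m≤n⊔o; m≤n⇒m≤o⊔n; module ≤-Reasoning )
open import Data.Fin using (Fin; zero; suc; _≟_; fromℕ<) renaming (_<_ to _<ᶠ_)
open import Data.Fin.Properties using (pigeonhole)
open import Data.Empty using (⊥-elim)
open import Data.Product using (Σ; ∃-syntax; ∃₂; _×_; _,_; proj₁; proj₂)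
open import Data.Sum as Sum using (_⊎_; inj₁; inj₂; [_,_]′)
open import Data.List using (List; []; _∷_; _++_; length; lookup; map; concatMap; tabulate)
open import Data.List.Properties using (length-tabulate)
open import Data.List.Membership.Propositional using (_∈_; _∉_)
open import Data.List.Membership.Propositional.Properties
  using (∈-lookup; ∈-∃++; ∈-tabulate⁺; ∈-tabulate⁻)
open import Data.List.Relation.Unary.All as All using (All; []; _∷_)
open import Data.List.Relation.Unary.All.Properties as All using (All¬⇒¬Any)
open import Data.List.Relation.Unary.AllPairs using (_∷_)
open import Data.List.Relation.Unary.Any as Any using (Any; here; there)
open import Data.List.Relation.Unary.Any.Properties as Any using (map⁺; concatMap⁺)
open import Data.List.Relation.Unary.Unique.Propositional using (Unique)
open import Data.List.Relation.Unary.Unique.Propositional.Properties as Unique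
  using (Unique[x∷xs]⇒x∉xs)
open import Data.List.Relation.Binary.Permutation.Propositional
  using (_↭_; ↭-refl; ↭-sym; ↭-trans; ↭⇒↭ₛ)
open import Data.List.Relation.Binary.Permutation.Propositional.Properties
  using (∈-resp-↭; ↭-length; shift)
open import Data.List.Relation.Binary.Permutation.Setoid.Properties using (Unique-resp-↭)
open import Function using (_∘_; case_of_)
open import Relation.Binary.PropositionalEquality
open import Relation.Nullary using (¬_; Dec; yes; no; does; contradiction)
open import Relation.Nullary.Decidable using (dec-true; dec-false)

does-≟-sym : ∀ {n} (i j : Fin n) → does (i ≟ j) ≡ does (j ≟ i)
does-≟-sym i j with i ≟ j | j ≟ i
... | yes _    | yes _    = refl
... | no _     | no _     = refl
... | yes refl | no j≢i   = contradiction refl j≢i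
... | no i≢j   | yes refl = contradiction refl i≢j

∈-∃↭ : ∀ {A : Set} {x : A} {xs} → x ∈ xs → ∃[ ys ] xs ↭ x ∷ ys
∈-∃↭ x∈xs with ys , zs , refl ← ∈-∃++ x∈xs = ys ++ zs , shift _ ys zs

Unique⇒lookup-distinct : ∀ {A : Set} {xs : List A} → Unique xs →
                         ∀ {i j} → i <ᶠ j → lookup xs i ≢ lookup xs j
Unique⇒lookup-distinct {xs = _ ∷ _} (x∉xs ∷ _) {zero}  {suc j} _ = All.lookup x∉xs (∈-lookup j)
Unique⇒lookup-distinct {xs = _ ∷ _} (_ ∷ unique) {suc i} {suc j} (s<s i<j) =
  Unique⇒lookup-distinct unique i<j

injectiveOn⇒length≤ : ∀ {A : Set} {n} {xs : List A} → Unique xs → (f : A → Fin n) →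
                      (∀ {x y} → x ∈ xs → y ∈ xs → f x ≡ f y → x ≡ y) → length xs ≤ n
injectiveOn⇒length≤ {n = n} {xs} unique f f-injective with length xs ≤? n
... | yes xs≤n = xs≤n
... | no xs≰n  =
  let i , j , i<j , fi≡fj = pigeonhole (≰⇒> xs≰n) (f ∘ lookup xs)
  in contradiction (f-injective (∈-lookup i) (∈-lookup j) fi≡fj) (Unique⇒lookup-distinct unique i<j)

module Walks (G : Graph) where

  infixr 5 _++ʷ_

  _++ʷ_ : ∀ {x y z} → Walk G x y → Walk G y z → Walk G x z
  [ _ ]    ++ʷ w′ = w′
  (e ∷ʷ w) ++ʷ w′ = e ∷ʷ (w ++ʷ w′)

  length-++ʷ : ∀ {x y z} (w : Walk G x y) (w′ : Walk G y z) →
               walkLength G (w ++ʷ w′) ≡ walkLength G w + walkLength G w′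
  length-++ʷ [ _ ]    w′ = refl
  length-++ʷ (e ∷ʷ w) w′ = cong suc (length-++ʷ w w′)

  onWalk-start : ∀ {x y} (w : Walk G x y) → OnWalk G x w
  onWalk-start [ x ]    = here-end
  onWalk-start (e ∷ʷ w) = here-step e w

  onWalk-end : ∀ {x y} (w : Walk G x y) → OnWalk G y w
  onWalk-end [ y ]    = here-end
  onWalk-end (e ∷ʷ w) = there e (onWalk-end w)

  onWalk-++ʳ : ∀ {a x y z} (w : Walk G x y) {w′ : Walk G y z} →
               OnWalk G a w′ → OnWalk G a (w ++ʷ w′)
  onWalk-++ʳ [ _ ]    a∈w′ = a∈w′
  onWalk-++ʳ (e ∷ʷ w) a∈w′ = there e (onWalk-++ʳ w a∈w′)

  record Split {x y} (w : Walk G x y) (a : V G) : Set where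
    field
      before       : Walk G x a
      after        : Walk G a y
      length-split : walkLength G before + walkLength G after ≡ walkLength G w
      onWalk-split : ∀ {b} → OnWalk G b w → OnWalk G b before ⊎ OnWalk G b after

  split : ∀ {a x y} {w : Walk G x y} → OnWalk G a w → Split w a
  split {a} here-end = record
    { before = [ a ] ; after = [ a ] ; length-split = refl ; onWalk-split = inj₁ }
  split {a} (here-step e w) = record
    { before = [ a ] ; after = e ∷ʷ w ; length-split = refl ; onWalk-split = inj₂ }
  split (there e {w} a∈w) = record
    { before       = e ∷ʷ before
    ; after        = after
    ; length-split = cong suc length-split
    ; onWalk-split = onWalk-split′
    }
    where
      open Split (split a∈w)
      onWalk-split′ : ∀ {b} → OnWalk G b (e ∷ʷ w) → OnWalk G b (e ∷ʷ before) ⊎ OnWalk G b after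
      onWalk-split′ (here-step _ _) = inj₁ (here-step e before)
      onWalk-split′ (there _ b∈w)   = Sum.map₁ (there e) (onWalk-split b∈w)

module GeneralPosition (G : Graph) where

  onCommonGeodesic-swap₁₂ : ∀ {a b c} → OnCommonGeodesic G a b c → OnCommonGeodesic G b a c
  onCommonGeodesic-swap₁₂ (x , y , w , shortest , a∈w , b∈w , c∈w) =
    x , y , w , shortest , b∈w , a∈w , c∈w

  onCommonGeodesic-swap₂₃ : ∀ {a b c} → OnCommonGeodesic G a b c → OnCommonGeodesic G a c b
  onCommonGeodesic-swap₂₃ (x , y , w , shortest , a∈w , b∈w , c∈w) =
    x , y , w , shortest , a∈w , c∈w , b∈w

  IsGP-tail : ∀ {x T} → IsGP G (x ∷ T) → IsGP G T
  IsGP-tail (_ ∷ unique , gp) = unique , λ a∈T b∈T c∈T → gp (there a∈T) (there b∈T) (there c∈T)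

  IsGP-resp-↭ : ∀ {S S′} → S ↭ S′ → IsGP G S → IsGP G S′
  IsGP-resp-↭ σ (unique , gp) =
    Unique-resp-↭ (setoid (V G)) (↭⇒↭ₛ σ) unique ,
    λ a∈ b∈ c∈ → gp (∈-resp-↭ (↭-sym σ) a∈) (∈-resp-↭ (↭-sym σ) b∈) (∈-resp-↭ (↭-sym σ) c∈)

  IsGP-∷ : ∀ {x T} → x ∉ T → IsGP G T →
           (∀ {b c} → b ∈ T → c ∈ T → b ≢ c → ¬ OnCommonGeodesic G x b c) → IsGP G (x ∷ T)
  IsGP-∷ {x} {T} x∉T (unique , gp) apex = All.tabulate (λ { b∈T refl → x∉T b∈T }) ∷ unique , gp′
    where
      gp′ : ∀ {a b c} → a ∈ x ∷ T → b ∈ x ∷ T → c ∈ x ∷ T → a ≢ b → a ≢ c → b ≢ c →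
            ¬ OnCommonGeodesic G a b c
      gp′ (here refl) (here refl) _           a≢b _   _   = contradiction refl a≢b
      gp′ (here refl) _           (here refl) _   a≢c _   = contradiction refl a≢c
      gp′ _           (here refl) (here refl) _   _   b≢c = contradiction refl b≢c
      gp′ (here refl) (there b∈T) (there c∈T) _   _   b≢c = apex b∈T c∈T b≢c
      gp′ (there a∈T) (here refl) (there c∈T) _   a≢c _   =
        apex a∈T c∈T a≢c ∘ onCommonGeodesic-swap₁₂
      gp′ (there a∈T) (there b∈T) (here refl) a≢b _   _   =
        apex a∈T b∈T a≢b ∘ onCommonGeodesic-swap₁₂ ∘ onCommonGeodesic-swap₂₃
      gp′ (there a∈T) (there b∈T) (there c∈T) = gp a∈T b∈T c∈T

record IsGraphDistance (G : Graph) (d : V G → V G → ℕ) : Set where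
  field
    d-self     : ∀ x → d x x ≡ 0
    d-edge     : ∀ {x x′} → E G x x′ → ∀ y → d x y ≤ suc (d x′ y)
    d-realised : ∀ x y → Σ (Walk G x y) λ w → walkLength G w ≡ d x y
    d-sym      : ∀ x y → d x y ≡ d y x

module GraphDistance {G : Graph} {d : V G → V G → ℕ} (isGraphDistance : IsGraphDistance G d) where

  open IsGraphDistance isGraphDistance
  open Walks G

  d≤walkLength : ∀ {x y} (w : Walk G x y) → d x y ≤ walkLength G w
  d≤walkLength {x}     [ _ ]    = ≤-reflexive (d-self x)
  d≤walkLength {y = y} (e ∷ʷ w) = ≤-trans (d-edge e y) (s≤s (d≤walkLength w))

  triangle : ∀ x y z → d x z ≤ d x y + d y z
  triangle x y z = begin
    d x z                             ≤⟨ d≤walkLength (w ++ʷ w′) ⟩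
    walkLength G (w ++ʷ w′)           ≡⟨ length-++ʷ w w′ ⟩
    walkLength G w + walkLength G w′  ≡⟨ cong₂ _+_ (proj₂ (d-realised x y))
                                                     (proj₂ (d-realised y z)) ⟩
    d x y + d y z                     ∎
    where
      open ≤-Reasoning
      w = proj₁ (d-realised x y)
      w′ = proj₁ (d-realised y z)

  IsGeodesic : ∀ {x y} → Walk G x y → Set
  IsGeodesic {x} {y} w = walkLength G w ≤ d x y

  isShortest⇒isGeodesic : ∀ {x y} {w : Walk G x y} → IsShortest G w → IsGeodesic w
  isShortest⇒isGeodesic {x} {y} shortest =
    ≤-trans (shortest (proj₁ (d-realised x y))) (≤-reflexive (proj₂ (d-realised x y)))

  isGeodesic⇒isShortest : ∀ {x y} {w : Walk G x y} → IsGeodesic w → IsShortest G w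
  isGeodesic⇒isShortest geodesic w′ = ≤-trans geodesic (d≤walkLength w′)

  Between : V G → V G → V G → Set
  Between x y z = d x y + d y z ≤ d x z

  between-reverse : ∀ {x y z} → Between x y z → Between z y x
  between-reverse {x} {y} {z} =
    subst₂ _≤_ (trans (+-comm (d x y) (d y z)) (cong₂ _+_ (d-sym y z) (d-sym x y))) (d-sym x z)

  between-innerTrans : ∀ {x a b y} → Between x a y → Between a b y → Between x a b
  between-innerTrans {x} {a} {b} {y} xay aby = +-cancelʳ-≤ (d b y) _ _ (begin
    d x a + d a b + d b y    ≡⟨ +-assoc (d x a) (d a b) (d b y) ⟩
    d x a + (d a b + d b y)  ≤⟨ +-monoʳ-≤ (d x a) aby ⟩
    d x a + d a y            ≤⟨ xay ⟩
    d x y                    ≤⟨ triangle x b y ⟩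
    d x b + d b y            ∎)
    where open ≤-Reasoning

  between-innerTrans′ : ∀ {x a b y} → Between x b a → Between x a y → Between b a y
  between-innerTrans′ xba xay =
    between-reverse (between-innerTrans (between-reverse xay) (between-reverse xba))

  onGeodesic⇒between : ∀ {x y a} {w : Walk G x y} → IsGeodesic w → OnWalk G a w → Between x a y
  onGeodesic⇒between geodesic a∈w =
    ≤-trans (+-mono-≤ (d≤walkLength before) (d≤walkLength after))
            (≤-trans (≤-reflexive length-split) geodesic)
    where open Split (split a∈w)

  module _ {x y a} {w : Walk G x y} (geodesic : IsGeodesic w) (a∈w : OnWalk G a w) where
    open Split (split a∈w)

    private
      pieces≤ : walkLength G before + walkLength G after ≤ d x a + d a y
      pieces≤ = ≤-trans (≤-reflexive length-split) (≤-trans geodesic (triangle x a y))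

    before-isGeodesic : IsGeodesic before
    before-isGeodesic = +-cancelʳ-≤ (walkLength G after) _ _
      (≤-trans pieces≤ (+-monoʳ-≤ (d x a) (d≤walkLength after)))

    after-isGeodesic : IsGeodesic after
    after-isGeodesic = +-cancelˡ-≤ (walkLength G before) _ _
      (≤-trans pieces≤ (+-monoˡ-≤ (d a y) (d≤walkLength before)))

    flanks⇒between : ∀ {b c} → OnWalk G b before → OnWalk G c after → Between b a c
    flanks⇒between b∈before c∈after = between-innerTrans
      (between-innerTrans′ (onGeodesic⇒between before-isGeodesic b∈before)
                           (onGeodesic⇒between geodesic a∈w))
      (onGeodesic⇒between after-isGeodesic c∈after)

  onGeodesicFrom⇒between : ∀ {p y b c} {w : Walk G p y} → IsGeodesic w →
                           OnWalk G b w → OnWalk G c w → Between p b c ⊎ Between p c b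
  onGeodesicFrom⇒between geodesic b∈w c∈w with Split.onWalk-split (split b∈w) c∈w
  ... | inj₁ c∈before = inj₂ (onGeodesic⇒between (before-isGeodesic geodesic b∈w) c∈before)
  ... | inj₂ c∈after  = inj₁ (between-innerTrans (onGeodesic⇒between geodesic b∈w)
                               (onGeodesic⇒between (after-isGeodesic geodesic b∈w) c∈after))

  onGeodesicTo⇒between : ∀ {x a b c} {w : Walk G x a} → IsGeodesic w →
                         OnWalk G b w → OnWalk G c w → Between b c a ⊎ Between c b a
  onGeodesicTo⇒between geodesic b∈w c∈w with Split.onWalk-split (split b∈w) c∈w
  ... | inj₁ c∈before = inj₂ (between-innerTrans′
                               (onGeodesic⇒between (before-isGeodesic geodesic b∈w) c∈before)
                               (onGeodesic⇒between geodesic b∈w))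
  ... | inj₂ c∈after  = inj₁ (onGeodesic⇒between (after-isGeodesic geodesic b∈w) c∈after)

  onCommonGeodesic⇒between : ∀ {a b c} → OnCommonGeodesic G a b c →
                             Between a b c ⊎ Between b a c ⊎ Between a c b
  onCommonGeodesic⇒between {a} (_ , _ , w , shortest , a∈w , b∈w , c∈w) =
    arrange (onWalk-split b∈w) (onWalk-split c∈w)
    where
      geodesic : IsGeodesic w
      geodesic = isShortest⇒isGeodesic shortest
      open Split (split a∈w)
      arrange : ∀ {b c} → OnWalk G b before ⊎ OnWalk G b after →
                OnWalk G c before ⊎ OnWalk G c after →
                Between a b c ⊎ Between b a c ⊎ Between a c b
      arrange (inj₂ b∈after) (inj₂ c∈after) =
        Sum.map₂ inj₂ (onGeodesicFrom⇒between (after-isGeodesic geodesic a∈w) b∈after c∈after)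
      arrange (inj₁ b∈before) (inj₁ c∈before) =
        [ (λ bca → inj₂ (inj₂ (between-reverse bca))) , (λ cba → inj₁ (between-reverse cba)) ]′
          (onGeodesicTo⇒between (before-isGeodesic geodesic a∈w) b∈before c∈before)
      arrange (inj₁ b∈before) (inj₂ c∈after) =
        inj₂ (inj₁ (flanks⇒between geodesic a∈w b∈before c∈after))
      arrange (inj₂ b∈after) (inj₁ c∈before) =
        inj₂ (inj₁ (between-reverse (flanks⇒between geodesic a∈w c∈before b∈after)))

  between⇒onCommonGeodesic : ∀ {a b c} → Between a b c → OnCommonGeodesic G a b c
  between⇒onCommonGeodesic {a} {b} {c} abc =
    a , c , w ++ʷ w′ , isGeodesic⇒isShortest geodesic ,
    onWalk-start (w ++ʷ w′) , onWalk-++ʳ w (onWalk-start w′) , onWalk-++ʳ w (onWalk-end w′)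
    where
      w = proj₁ (d-realised a b)
      w′ = proj₁ (d-realised b c)
      geodesic : IsGeodesic (w ++ʷ w′)
      geodesic = begin
        walkLength G (w ++ʷ w′)           ≡⟨ length-++ʷ w w′ ⟩
        walkLength G w + walkLength G w′  ≡⟨ cong₂ _+_ (proj₂ (d-realised a b))
                                                         (proj₂ (d-realised b c)) ⟩
        d a b + d b c                     ≤⟨ abc ⟩
        d a c                             ∎
        where open ≤-Reasoning

  isosceles⇒¬onCommonGeodesic : ∀ {a b c} → d a b ≡ d a c → 0 < d b c → d b c < d a b + d a c →
                                ¬ OnCommonGeodesic G a b c
  isosceles⇒¬onCommonGeodesic {a} {b} {c} legs base>0 base<legs col
    with onCommonGeodesic⇒between col
  ... | inj₁ abc        = <⇒≱ (m<m+n (d a b) base>0) (≤-trans abc (≤-reflexive (sym legs)))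
  ... | inj₂ (inj₁ bac) = <⇒≱ base<legs (subst (λ ab → ab + d a c ≤ d b c) (d-sym b a) bac)
  ... | inj₂ (inj₂ acb) =
    <⇒≱ (m<m+n (d a c) (subst (0 <_) (d-sym b c) base>0)) (≤-trans acb (≤-reflexive legs))

  unitDistances⇒IsGP : ∀ {S} → Unique S → (∀ {a b} → a ∈ S → b ∈ S → a ≢ b → d a b ≡ 1) → IsGP G S
  unitDistances⇒IsGP unique unit = unique , λ a∈S b∈S c∈S a≢b a≢c b≢c →
    let ab = unit a∈S b∈S a≢b ; ac = unit a∈S c∈S a≢c ; bc = unit b∈S c∈S b≢c
    in isosceles⇒¬onCommonGeodesic (trans ab (sym ac)) (subst (0 <_) (sym bc) z<s)
         (subst₂ _<_ (sym bc) (sym (cong₂ _+_ ab ac)) (s<s z<s))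

module Moves (G : Graph) where

  moveSeq-invariant : ∀ {P : List (V G) → Set} → (∀ {S S′} → LegalMove G S S′ → P S → P S′) →
                      ∀ {S cs} → P S → MoveSeq G S cs → All P cs
  moveSeq-invariant preserved PS done            = []
  moveSeq-invariant preserved PS (step move seq) =
    let PS′ = preserved move PS in PS′ ∷ moveSeq-invariant preserved PS′ seq

  moveSeq-resp-↭ : ∀ {S S′ cs} → S ↭ S′ → MoveSeq G S′ cs → MoveSeq G S cs
  moveSeq-resp-↭ σ done = done
  moveSeq-resp-↭ σ (step (u , v , T , σ′ , e , v∉S′ , eq , gp) seq) =
    step (u , v , T , ↭-trans σ σ′ , e , v∉S′ ∘ ∈-resp-↭ σ , eq , gp) seq

module Tours (G : Graph) (irreflexive : ∀ {x} → ¬ E G x x) where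

  open Moves G

  -- One robot walks from p to z while the robots on T stay put.
  data Tour (T : List (V G)) : V G → V G → Set where
    stop : ∀ {p} → Tour T p p
    move : ∀ {p q z} → E G p q → IsGP G (q ∷ T) → Tour T q z → Tour T p z

  stops : ∀ {T p z} → Tour T p z → List (V G)
  stops stop                 = []
  stops (move {q = q} _ _ R) = q ∷ stops R

  tour-moves : ∀ {T p z cs} (R : Tour T p z) → MoveSeq G (z ∷ T) cs →
               MoveSeq G (p ∷ T) (map (_∷ T) (stops R) ++ cs)
  tour-moves stop seq = seq
  tour-moves {T} {p} (move {q = q} e gp R) seq =
    step (p , q , T , ↭-refl , e , q∉p∷T , refl , gp) (tour-moves R seq)
    where
      q∉p∷T : q ∉ p ∷ T
      q∉p∷T (here refl) = irreflexive e
      q∉p∷T (there q∈T) = Unique[x∷xs]⇒x∉xs (proj₁ gp) q∈T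

  starTour : ∀ {T c z} → IsGP G (c ∷ T) → (ls : List (V G)) →
             All (λ l → E G c l × E G l c × IsGP G (l ∷ T)) ls → Tour T c z → Tour T c z
  starTour gc []       []                    R = R
  starTour gc (l ∷ ls) ((cl , lc , gl) ∷ ps) R = move cl gl (move lc gc (starTour gc ls ps R))

  ∈-starTour : ∀ {T c z l ls} (gc : IsGP G (c ∷ T)) ps (R : Tour T c z) →
               l ∈ ls → l ∈ stops (starTour gc ls ps R)
  ∈-starTour gc (_ ∷ ps) R (here refl)  = here refl
  ∈-starTour gc (_ ∷ ps) R (there l∈ls) = there (there (∈-starTour gc ps R l∈ls))

  record Round (S : List (V G)) : Set where
    field
      mover       : V G
      others      : List (V G)
      arrangement : S ↭ mover ∷ others
      tour        : Tour others mover mover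

    configurations : List (List (V G))
    configurations = map (_∷ others) (stops tour)

  open Round

  rounds-moves : ∀ {S} (ρs : List (Round S)) → MoveSeq G S (concatMap configurations ρs)
  rounds-moves []       = done
  rounds-moves (ρ ∷ ρs) = moveSeq-resp-↭ (arrangement ρ)
    (tour-moves (tour ρ) (moveSeq-resp-↭ (↭-sym (arrangement ρ)) (rounds-moves ρs)))

  stops⇒configurations : ∀ {S x} (ρ : Round S) → x ∈ stops (tour ρ) → Any (x ∈_) (configurations ρ)
  stops⇒configurations ρ x∈stops = map⁺ (Any.map here x∈stops)

  rounds⇒IsMobileGP : ∀ {S} → IsGP G S → (ρs : List (Round S)) →
                      (∀ x → x ∈ S ⊎ Any (λ ρ → x ∈ stops (tour ρ)) ρs) → IsMobileGP G S
  rounds⇒IsMobileGP gp ρs covered = gp , _ , rounds-moves ρs , λ x →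
    Sum.map₂ (λ visited → concatMap⁺ configurations
                            (Any.map (λ {ρ} → stops⇒configurations ρ) visited))
             (covered x)

module Corona (r s : ℕ) where

  G : Graph
  G = K r ⊙ K s

  Vertex : Set
  Vertex = V G

  pattern core i   = inj₁ i
  pattern leaf i t = inj₂ (i , t)

  block : Vertex → Fin r
  block (core i)   = i
  block (leaf i _) = i

  depth : Vertex → ℕ
  depth (core _)   = 0
  depth (leaf _ _) = 1

  -- Each block {v_i} ∪ H^i is a clique; a shortest path between different blocks
  -- runs through both cores.
  dist : Vertex → Vertex → ℕ
  dist (core i)   (core j)   = if does (i ≟ j) then 0 else 1
  dist (core i)   (leaf j _) = if does (i ≟ j) then 1 else 2
  dist (leaf i _) (core j)   = if does (i ≟ j) then 1 else 2
  dist (leaf i t) (leaf j u) = if does (i ≟ j) then (if does (t ≟ u) then 0 else 1) else 3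

  dist-self : ∀ x → dist x x ≡ 0
  dist-self (core i)   rewrite dec-true (i ≟ i) refl = refl
  dist-self (leaf i t) rewrite dec-true (i ≟ i) refl | dec-true (t ≟ t) refl = refl

  dist-sameBlock : ∀ {x y} → block x ≡ block y → x ≢ y → dist x y ≡ 1
  dist-sameBlock {core _}   {core _}   refl x≢y = contradiction refl x≢y
  dist-sameBlock {core i}   {leaf _ _} refl _   rewrite dec-true (i ≟ i) refl = refl
  dist-sameBlock {leaf i _} {core _}   refl _   rewrite dec-true (i ≟ i) refl = refl
  dist-sameBlock {leaf i t} {leaf _ u} refl x≢y
    rewrite dec-true (i ≟ i) refl | dec-false (t ≟ u) (λ { refl → x≢y refl }) = refl

  dist-apart : ∀ {x y} → block x ≢ block y → dist x y ≡ suc (depth x + depth y)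
  dist-apart {core i}   {core j}   i≢j rewrite dec-false (i ≟ j) i≢j = refl
  dist-apart {core i}   {leaf j _} i≢j rewrite dec-false (i ≟ j) i≢j = refl
  dist-apart {leaf i _} {core j}   i≢j rewrite dec-false (i ≟ j) i≢j = refl
  dist-apart {leaf i _} {leaf j _} i≢j rewrite dec-false (i ≟ j) i≢j = refl

  dist-edge : ∀ {x x′} → E G x x′ → ∀ y → dist x y ≤ suc (dist x′ y)
  dist-edge {core i}   {core _}   _ (core j) with i ≟ j
  ... | yes _ = z≤n
  ... | no _  = s≤s z≤n
  dist-edge {core i}   {core i′}  _ (leaf j _) with i ≟ j | i′ ≟ j
  ... | yes _ | _     = s≤s z≤n
  ... | no _  | yes _ = s≤s (s≤s z≤n)
  ... | no _  | no _  = s≤s (s≤s z≤n)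
  dist-edge {core i}   {leaf _ _} refl (core j) with i ≟ j
  ... | yes _ = z≤n
  ... | no _  = s≤s z≤n
  dist-edge {core i}   {leaf _ _} refl (leaf j _) with i ≟ j
  ... | yes _ = s≤s z≤n
  ... | no _  = s≤s (s≤s z≤n)
  dist-edge {leaf i _} {core _}   refl (core j) with i ≟ j
  ... | yes _ = s≤s z≤n
  ... | no _  = s≤s (s≤s z≤n)
  dist-edge {leaf i t} {core _}   refl (leaf j u) with i ≟ j
  ... | no _  = s≤s (s≤s (s≤s z≤n))
  ... | yes _ with t ≟ u
  ...   | yes _ = z≤n
  ...   | no _  = s≤s z≤n
  dist-edge {leaf _ _} {leaf _ _} (refl , _) (core j) = n≤1+n _
  dist-edge {leaf i t} {leaf _ _} (refl , _) (leaf j u) with i ≟ j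
  ... | no _  = n≤1+n 3
  ... | yes _ with t ≟ u
  ...   | yes _ = z≤n
  ...   | no _  = s≤s z≤n

  dist-realised : ∀ x y → Σ (Walk G x y) λ w → walkLength G w ≡ dist x y
  dist-realised (core i) (core j) with i ≟ j
  ... | yes refl = [ core i ] , refl
  ... | no i≢j   = (i≢j ∷ʷ [ core j ]) , refl
  dist-realised (core i) (leaf j u) with i ≟ j
  ... | yes refl = (refl ∷ʷ [ leaf j u ]) , refl
  ... | no i≢j   = (i≢j ∷ʷ (refl ∷ʷ [ leaf j u ])) , refl
  dist-realised (leaf i t) (core j) with i ≟ j
  ... | yes refl = (refl ∷ʷ [ core j ]) , refl
  ... | no i≢j   = (refl ∷ʷ (i≢j ∷ʷ [ core j ])) , refl
  dist-realised (leaf i t) (leaf j u) with i ≟ j | t ≟ u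
  ... | yes refl | yes refl = [ leaf j u ] , refl
  ... | yes refl | no t≢u   = ((refl , t≢u) ∷ʷ [ leaf j u ]) , refl
  ... | no i≢j   | _        = (refl ∷ʷ (i≢j ∷ʷ (refl ∷ʷ [ leaf j u ]))) , refl

  dist-sym : ∀ x y → dist x y ≡ dist y x
  dist-sym (core i)   (core j)   = cong (λ b → if b then 0 else 1) (does-≟-sym i j)
  dist-sym (core i)   (leaf j _) = cong (λ b → if b then 1 else 2) (does-≟-sym i j)
  dist-sym (leaf i _) (core j)   = cong (λ b → if b then 1 else 2) (does-≟-sym i j)
  dist-sym (leaf i t) (leaf j u) =
    cong₂ (λ b b′ → if b then (if b′ then 0 else 1) else 3) (does-≟-sym i j) (does-≟-sym t u)

  dist-isGraphDistance : IsGraphDistance G dist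
  dist-isGraphDistance = record
    { d-self     = dist-self
    ; d-edge     = λ {x} {x′} → dist-edge {x} {x′}
    ; d-realised = dist-realised
    ; d-sym      = dist-sym
    }

  open GraphDistance dist-isGraphDistance
  open GeneralPosition G
  open Moves G

  irreflexive : ∀ {x} → ¬ E G x x
  irreflexive {core _}   i≢i       = i≢i refl
  irreflexive {leaf _ _} (_ , t≢t) = t≢t refl

  open Tours G (λ {x} → irreflexive {x})

  apex-¬onCommonGeodesic : ∀ {a b c} → block a ≢ block b → block a ≢ block c → depth b ≡ depth c →
                           dist b c ≡ 1 → ¬ OnCommonGeodesic G a b c
  apex-¬onCommonGeodesic {a} {b} {c} a≁b a≁c depths base =
    isosceles⇒¬onCommonGeodesic legs (subst (0 <_) (sym base) z<s)
      (subst (_< dist a b + dist a c) (sym base) 1<legs)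
    where
      legs : dist a b ≡ dist a c
      legs = trans (dist-apart {a} {b} a≁b)
                   (trans (cong (λ k → suc (depth a + k)) depths) (sym (dist-apart {a} {c} a≁c)))
      1<legs : 1 < dist a b + dist a c
      1<legs rewrite dist-apart {a} {b} a≁b | dist-apart {a} {c} a≁c = s<s (≤-trans z<s (m≤n+m _ _))

  leaf-core-between : ∀ {i t x} → block x ≢ i → Between (leaf i t) (core i) x
  leaf-core-between {i} {t} {x} x≁i
    rewrite dist-sameBlock {leaf i t} {core i} refl (λ ())
          | dist-apart {core i} {x} (x≁i ∘ sym)
          | dist-apart {leaf i t} {x} (x≁i ∘ sym) = ≤-refl

  -- Upper bound

  position : Vertex → Fin (suc s)
  position (core _)   = zero
  position (leaf _ t) = suc t

  block-position-injective : ∀ {x y} → block x ≡ block y → position x ≡ position y → x ≡ y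
  block-position-injective {core _}   {core _}   refl _    = refl
  block-position-injective {leaf _ _} {leaf _ _} refl refl = refl

  module _ {S i t} (gp : IsGP G S) (leaf∈S : leaf i t ∈ S) (core∈S : core i ∈ S) where

    leaf-core⇒inBlock : ∀ {x} → x ∈ S → block x ≡ i
    leaf-core⇒inBlock {x} x∈S with block x ≟ i
    ... | yes x∼i = x∼i
    ... | no x≁i  = contradiction (between⇒onCommonGeodesic (leaf-core-between {i} {t} {x} x≁i))
                      (proj₂ gp leaf∈S core∈S x∈S (λ ()) (λ { refl → x≁i refl })
                                                         (λ { refl → x≁i refl }))

    leaf-core⇒length≤ : length S ≤ suc s
    leaf-core⇒length≤ = injectiveOn⇒length≤ (proj₁ gp) position λ x∈S y∈S →
      block-position-injective (trans (leaf-core⇒inBlock x∈S) (sym (leaf-core⇒inBlock y∈S)))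

  long-leaf⇒core∉ : ∀ {S i t} → IsGP G S → suc s < length S → leaf i t ∈ S → core i ∉ S
  long-leaf⇒core∉ gp long leaf∈S core∈S = <⇒≱ long (leaf-core⇒length≤ gp leaf∈S core∈S)

  leaf-neighbour : ∀ {i t w} → E G (leaf i t) w → w ≡ core i ⊎ ∃[ u ] w ≡ leaf i u
  leaf-neighbour {w = core _}   refl       = inj₁ refl
  leaf-neighbour {w = leaf _ u} (refl , _) = inj₂ (u , refl)

  TwoLeaves : Fin r → List Vertex → Set
  TwoLeaves i S = ∃₂ λ t u → t ≢ u × leaf i t ∈ S × leaf i u ∈ S

  Trapped : Fin r → List Vertex → Set
  Trapped i S = IsGP G S × suc s < length S × TwoLeaves i S

  trapped⇒core∉ : ∀ {i S} → Trapped i S → core i ∉ S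
  trapped⇒core∉ (gp , long , _ , _ , _ , leaf∈S , _) = long-leaf⇒core∉ gp long leaf∈S

  legalMove-trapped : ∀ {i S S′} → LegalMove G S S′ → Trapped i S → Trapped i S′
  legalMove-trapped {i} {S} (u , w , T , σ , e , w∉S , refl , gp′)
                            (_ , long , t , t′ , t≢t′ , leaf∈S , leaf′∈S) =
    gp′ , long′ , two (∈-resp-↭ σ leaf∈S) (∈-resp-↭ σ leaf′∈S)
    where
      long′ : suc s < length (w ∷ T)
      long′ = subst (suc s <_) (↭-length σ) long
      moved : ∀ {t t′} → E G (leaf i t) w → leaf i t′ ∈ S → leaf i t′ ∈ T → TwoLeaves i (w ∷ T)
      moved {t} {t′} e leaf′∈S leaf′∈T with leaf-neighbour {i} {t} {w} e
      ... | inj₁ refl       = ⊥-elim (long-leaf⇒core∉ gp′ long′ (there leaf′∈T) (here refl))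
      ... | inj₂ (u , refl) = u , t′ , (λ { refl → w∉S leaf′∈S }) , here refl , there leaf′∈T
      two : leaf i t ∈ u ∷ T → leaf i t′ ∈ u ∷ T → TwoLeaves i (w ∷ T)
      two (here refl)    (here refl)     = contradiction refl t≢t′
      two (there leaf∈T) (there leaf′∈T) = t , t′ , t≢t′ , there leaf∈T , there leaf′∈T
      two (here refl)    (there leaf′∈T) = moved e leaf′∈S leaf′∈T
      two (there leaf∈T) (here refl)     =
        let u , v , u≢v , u∈ , v∈ = moved e leaf∈S leaf∈T in v , u , u≢v ∘ sym , v∈ , u∈

  mobile⇒¬twoLeaves : ∀ {i S} → IsMobileGP G S → suc s < length S → ¬ TwoLeaves i S
  mobile⇒¬twoLeaves {i} (gp , _ , moves , covers) long two =
    [ trapped⇒core∉ trapped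
    , All¬⇒¬Any (All.map trapped⇒core∉ (moveSeq-invariant legalMove-trapped trapped moves)) ]′
      (covers (core i))
    where
      trapped : Trapped i _
      trapped = gp , long , two

  long-mobile⇒length≤ : ∀ {S} → IsMobileGP G S → suc s < length S → length S ≤ r
  long-mobile⇒length≤ {S} mobile@(gp , _) long = injectiveOn⇒length≤ (proj₁ gp) block one-per-block
    where
      one-per-block : ∀ {x y} → x ∈ S → y ∈ S → block x ≡ block y → x ≡ y
      one-per-block {core _}   {core _}   _      _      refl = refl
      one-per-block {core _}   {leaf _ _} core∈S leaf∈S refl =
        ⊥-elim (long-leaf⇒core∉ gp long leaf∈S core∈S)
      one-per-block {leaf _ _} {core _}   leaf∈S core∈S refl =
        ⊥-elim (long-leaf⇒core∉ gp long leaf∈S core∈S)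
      one-per-block {leaf _ t} {leaf _ u} leaf∈S leaf′∈S refl with t ≟ u
      ... | yes refl = refl
      ... | no t≢u   = ⊥-elim (mobile⇒¬twoLeaves mobile long (t , u , t≢u , leaf∈S , leaf′∈S))

  isMobileGP⇒length≤ : ∀ S → IsMobileGP G S → length S ≤ r ⊔ suc s
  isMobileGP⇒length≤ S mobile with length S ≤? suc s
  ... | yes short = m≤n⇒m≤o⊔n r short
  ... | no ¬short = m≤n⇒m≤n⊔o (suc s) (long-mobile⇒length≤ mobile (≰⇒> ¬short))

  -- Lower bound

  leaves : Fin r → List Vertex
  leaves i = tabulate (leaf i)

  blockSet : Fin r → List Vertex
  blockSet i = core i ∷ leaves i

  ∈-blockSet⁻ : ∀ {i x} → x ∈ blockSet i → block x ≡ i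
  ∈-blockSet⁻ (here refl) = refl
  ∈-blockSet⁻ (there x∈leaves) with _ , refl ← ∈-tabulate⁻ x∈leaves = refl

  ∈-blockSet⁺ : ∀ {i} x → block x ≡ i → x ∈ blockSet i
  ∈-blockSet⁺ (core _)   refl = here refl
  ∈-blockSet⁺ (leaf _ t) refl = there (∈-tabulate⁺ t)

  blockSet-isGP : ∀ i → IsGP G (blockSet i)
  blockSet-isGP i = unitDistances⇒IsGP (All.tabulate⁺ (λ _ ()) ∷ Unique.tabulate⁺ λ { refl → refl })
    λ x∈ y∈ → dist-sameBlock (trans (∈-blockSet⁻ x∈) (sym (∈-blockSet⁻ y∈)))

  outside-isGP : ∀ {i x} → block x ≢ i → IsGP G (x ∷ leaves i)
  outside-isGP {i} {x} x≁i =
    IsGP-∷ (λ x∈ → x≁i (∈-blockSet⁻ (there x∈))) (IsGP-tail (blockSet-isGP i)) apex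
    where
      apex : ∀ {b c} → b ∈ leaves i → c ∈ leaves i → b ≢ c → ¬ OnCommonGeodesic G x b c
      apex b∈ c∈ b≢c with _ , refl ← ∈-tabulate⁻ b∈ | _ , refl ← ∈-tabulate⁻ c∈ =
        apex-¬onCommonGeodesic x≁i x≁i refl (dist-sameBlock refl b≢c)

  blockTour : ∀ {T i z} → IsGP G (core i ∷ T) → (∀ t → IsGP G (leaf i t ∷ T)) →
              Tour T (core i) z → Tour T (core i) z
  blockTour gc gl = starTour gc (leaves _) (All.tabulate⁺ λ t → refl , refl , gl t)

  leaf∈blockTour : ∀ {T i z t} (gc : IsGP G (core i ∷ T)) gl (R : Tour T (core i) z) →
                   leaf i t ∈ stops (blockTour gc gl R)
  leaf∈blockTour {t = t} gc gl R = ∈-starTour gc _ R (∈-tabulate⁺ t)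

  module BlockSet (o : Fin r) where

    excursion : (k : Fin r) → Dec (k ≡ o) → Tour (leaves o) (core o) (core o)
    excursion k (yes _)  = stop
    excursion k (no k≢o) =
      move (k≢o ∘ sym) (outside-isGP k≢o)
        (blockTour (outside-isGP k≢o) (λ _ → outside-isGP k≢o) (move k≢o (blockSet-isGP o) stop))

    round : Fin r → Round (blockSet o)
    round k = record
      { mover = core o ; others = leaves o ; arrangement = ↭-refl ; tour = excursion k (k ≟ o) }

    visited : ∀ x → block x ≢ o → x ∈ stops (excursion (block x) (block x ≟ o))
    visited (core k) k≢o with k ≟ o
    ... | yes k≡o = contradiction k≡o k≢o
    ... | no _    = here refl
    visited (leaf k t) k≢o with k ≟ o
    ... | yes k≡o = contradiction k≡o k≢o
    ... | no _    = there (leaf∈blockTour _ _ _)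

    blockSet-isMobileGP : IsMobileGP G (blockSet o)
    blockSet-isMobileGP = rounds⇒IsMobileGP (blockSet-isGP o) (tabulate round) covered
      where
        covered : ∀ x → x ∈ blockSet o ⊎ Any (λ ρ → x ∈ stops (Round.tour ρ)) (tabulate round)
        covered x with block x ≟ o
        ... | yes x∼o = inj₁ (∈-blockSet⁺ x x∼o)
        ... | no x≁o  = inj₂ (Any.tabulate⁺ (block x) (visited x x≁o))

  cores : List Vertex
  cores = tabulate core

  cores-isGP : IsGP G cores
  cores-isGP = unitDistances⇒IsGP (Unique.tabulate⁺ λ { refl → refl }) unit
    where
      unit : ∀ {x y} → x ∈ cores → y ∈ cores → x ≢ y → dist x y ≡ 1
      unit x∈ y∈ x≢y with i , refl ← ∈-tabulate⁻ x∈ | j , refl ← ∈-tabulate⁻ y∈ =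
        dist-apart {core i} {core j} λ { refl → x≢y refl }

  module CoreRound (i : Fin r) where

    private
      extraction : ∃[ T ] cores ↭ core i ∷ T
      extraction = ∈-∃↭ (∈-tabulate⁺ i)

    others : List Vertex
    others = proj₁ extraction

    arrangement : cores ↭ core i ∷ others
    arrangement = proj₂ extraction

    mover-isGP : IsGP G (core i ∷ others)
    mover-isGP = IsGP-resp-↭ arrangement cores-isGP

    ∈-others⁻ : ∀ {x} → x ∈ others → ∃[ j ] x ≡ core j × j ≢ i
    ∈-others⁻ x∈ with j , refl ← ∈-tabulate⁻ (∈-resp-↭ (↭-sym arrangement) (there x∈)) =
      j , refl , λ { refl → Unique[x∷xs]⇒x∉xs (proj₁ mover-isGP) x∈ }

    leaf-isGP : ∀ t → IsGP G (leaf i t ∷ others)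
    leaf-isGP t =
      IsGP-∷ (λ leaf∈ → case ∈-others⁻ leaf∈ of λ { (_ , () , _) }) (IsGP-tail mover-isGP) apex
      where
        apex : ∀ {b c} → b ∈ others → c ∈ others → b ≢ c → ¬ OnCommonGeodesic G (leaf i t) b c
        apex b∈ c∈ b≢c with j , refl , j≢i ← ∈-others⁻ b∈ | l , refl , l≢i ← ∈-others⁻ c∈ =
          apex-¬onCommonGeodesic (j≢i ∘ sym) (l≢i ∘ sym) refl
            (dist-apart {core j} {core l} λ { refl → b≢c refl })

    round : Round cores
    round = record
      { mover = core i ; others = others ; arrangement = arrangement
      ; tour = blockTour mover-isGP leaf-isGP stop }

  cores-isMobileGP : IsMobileGP G cores
  cores-isMobileGP = rounds⇒IsMobileGP cores-isGP (tabulate CoreRound.round) covered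
    where
      covered : ∀ x → x ∈ cores ⊎ Any (λ ρ → x ∈ stops (Round.tour ρ)) (tabulate CoreRound.round)
      covered (core i)   = inj₁ (∈-tabulate⁺ i)
      covered (leaf i t) = inj₂ (Any.tabulate⁺ i (leaf∈blockTour _ _ stop))

corollary4p2 : (r s : ℕ) → 1 ≤ r → 1 ≤ s → MobIs (K r ⊙ K s) (r ⊔ suc s)
corollary4p2 r s 1≤r _ = largest , isMobileGP⇒length≤
  where
    open Corona r s
    largest : ∃[ S ] (IsMobileGP G S × length S ≡ r ⊔ suc s)
    largest with ⊔-sel r (suc s)
    ... | inj₁ max≡r   = cores , cores-isMobileGP , trans (length-tabulate core) (sym max≡r)
    ... | inj₂ max≡1+s = blockSet o , BlockSet.blockSet-isMobileGP o ,
                         trans (cong suc (length-tabulate (leaf o))) (sym max≡1+s)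
      where o = fromℕ< 1≤r
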